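{- Let $G=(A\cup B,E)$ be a marriage instance with critical set $C\subseteq A$, and let $G''$ be the instance constructed from $G$ as described in the context. In any stable matching $M''$ of $G''$, for every $m\in A$, at most one copy of $m$ is matched to a non-dummy woman (a woman of $B$).
   Context: A marriage instance is a bipartite graph $G=(A\cup B,E)$ ($A$ men, $B$ women) with strict preference lists; $\mathrm{Pref}(v)$ denotes the list of $v$; every vertex prefers being matched to being unmatched. A matching is stable if no edge $(a,b)$ outside it has both endpoints preferring each other to their current partners. Construction of $G''=(A''\cup B'',E'')$: let $\ell=|C|$. For $m\in C$, $A''$ contains copies $m^0,\dots,m^{\ell+1}$ and $B''$ contains dummies $d_m^1,\dots,d_m^{\ell+1}$. For $m\in A\setminus C$, $A''$ contains copies $m^0,m^1$ and $B''$ contains one dummy $d_m^1$. $B''$ also contains all of $B$. Preferences: for $m\in A\setminus C$: $m^0$: $\mathrm{Pref}(m)$ followed by $d_m^1$; $m^1$: $d_m^1$ followed by $\mathrm{Pref}(m)$. For $m\in C$: $m^0$: $\mathrm{Pref}(m)$ followed by $d_m^1$; $m^i$ ($1\le i\le \ell$): $d_m^i$, then $\mathrm{Pref}(m)$, then $d_m^{i+1}$; $m^{\ell+1}$: $d_m^{\ell+1}$ followed by $\mathrm{Pref}(m)$. For $w\in B$: the existing level-$(\ell+1)$ copies of the men of $\mathrm{Pref}(w)$ in the order of $\mathrm{Pref}(w)$, then the level-$\ell$ copies, and so on down to the level-$0$ copies. For a dummy $d_m^i$: $m^{i-1}$ then $m^i$. -}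

module Defs where

open import Data.Nat using (ℕ; zero; suc; _<_; _<?_)
open import Data.Fin using (Fin; zero; suc; toℕ; fromℕ<; inject₁)
open import Data.Fin.Subset using (Subset; _∈_; ∣_∣)
open import Data.Fin.Subset.Properties using (_∈?_)
open import Data.List using (List; []; _∷_; _++_; map; concatMap; mapMaybe; downFrom)
open import Data.List.Membership.Propositional using () renaming (_∈_ to _∈ₗ_)
open import Data.List.Relation.Unary.Unique.Propositional using (Unique)
open import Data.Maybe using (Maybe; just; nothing)
open import Data.Product using (Σ; ∃; ∃₂; _×_; _,_)
open import Data.Sum using (_⊎_; inj₁; inj₂)
open import Relation.Nullary using (¬_; yes; no)
open import Relation.Binary.PropositionalEquality using (_≡_)
open import Function.Bundles using (_⇔_)

record Instance (M W : Set) : Set where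
  field
    prefM : M → List W   -- Pref(m), most preferred first
    prefW : W → List M   -- Pref(w), most preferred first
open Instance public

record WellFormed {M W : Set} (I : Instance M W) : Set where
  field
    uniqueM : ∀ a → Unique (prefM I a)
    uniqueW : ∀ b → Unique (prefW I b)
    mutualAcc : ∀ a b → (b ∈ₗ prefM I a) ⇔ (a ∈ₗ prefW I b)

Edge : {M W : Set} → Instance M W → M → W → Set
Edge I a b = (b ∈ₗ prefM I a) × (a ∈ₗ prefW I b)

Before : {X : Set} → List X → X → X → Set
Before l x y = ∃₂ λ l₁ l₂ → (l ≡ l₁ ++ (x ∷ l₂)) × (y ∈ₗ l₂)

record IsMatching {M W : Set} (I : Instance M W) (μ : M → W → Set) : Set where
  field
    inE     : ∀ a b → μ a b → Edge I a b
    funM    : ∀ a b b' → μ a b → μ a b' → b ≡ b'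
    funW    : ∀ a a' b → μ a b → μ a' b → a ≡ a'

PrefersM : {M W : Set} → Instance M W → (M → W → Set) → M → W → Set
PrefersM I μ a b = (∀ b' → ¬ μ a b') ⊎ (∃ λ b' → μ a b' × Before (prefM I a) b b')

PrefersW : {M W : Set} → Instance M W → (M → W → Set) → W → M → Set
PrefersW I μ b a = (∀ a' → ¬ μ a' b) ⊎ (∃ λ a' → μ a' b × Before (prefW I b) a a')

record IsStable {M W : Set} (I : Instance M W) (μ : M → W → Set) : Set where
  field
    matching : IsMatching I μ
    noBlock  : ∀ a b → Edge I a b → ¬ μ a b → ¬ (PrefersM I μ a b × PrefersW I μ b a)

module Construction {nA nB : ℕ} (G : Instance (Fin nA) (Fin nB)) (C : Subset nA) where

  ℓ : ℕ
  ℓ = ∣ C ∣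

  top : Fin nA → ℕ
  top m with m ∈? C
  ... | yes _ = suc ℓ
  ... | no  _ = 1

  Men'' : Set
  Men'' = Σ (Fin nA) (λ m → Fin (suc (top m)))

  -- women of G'' : women of B (inj₁) and dummies d_m^{j+1} for j : Fin (top m) (inj₂)
  Women'' : Set
  Women'' = Fin nB ⊎ Σ (Fin nA) (λ m → Fin (top m))

  dummyBefore : (m : Fin nA) → Fin (suc (top m)) → List Women''
  dummyBefore m zero    = []
  dummyBefore m (suc j) = inj₂ (m , j) ∷ []          -- d_m^i for copy m^i, i ≥ 1

  dummyAfter : (m : Fin nA) → Fin (suc (top m)) → List Women''
  dummyAfter m i with toℕ i <? top m
  ... | yes p = inj₂ (m , fromℕ< p) ∷ []             -- d_m^{i+1} when i < top m
  ... | no  _ = []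

  prefMen'' : Men'' → List Women''
  prefMen'' (m , i) = dummyBefore m i ++ (map inj₁ (prefM G m) ++ dummyAfter m i)

  copyAt : ℕ → Fin nA → Maybe Men''
  copyAt k m with k <? suc (top m)
  ... | yes p = just (m , fromℕ< p)
  ... | no  _ = nothing

  -- level ℓ+1 copies first, then level ℓ, ..., down to level 0
  prefWomen'' : Women'' → List Men''
  prefWomen'' (inj₁ w)       = concatMap (λ k → mapMaybe (copyAt k) (prefW G w)) (downFrom (suc (suc ℓ)))
  prefWomen'' (inj₂ (m , j)) = (m , inject₁ j) ∷ (m , suc j) ∷ []   -- d_m^{j+1} : m^j then m^{j+1}

  G'' : Instance Men'' Women''
  G'' = record { prefM = prefMen'' ; prefW = prefWomen'' }

-- Suppose m^i is matched to a woman of B and k > i. If m^k were matched to anyone but its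
-- lower dummy d_m^k, then m^k would rank d_m^k first, and d_m^k (whose only acceptable men
-- are m^{k-1} and m^k) would be free unless m^{k-1} holds her; so stability forces m^{k-1}
-- onto its upper dummy d_m^k. Repeating this downwards pins every copy between i and k to
-- its upper dummy, which at level i contradicts m^i being matched into B.
module Submission where

open import Defs
open import Data.Nat using (ℕ; suc; _≤_; _<_)
open import Data.Nat.Properties using (<-cmp; ≤-reflexive; 1+n≰n; m<1+n⇒m<n∨m≡n)
open import Data.Fin using (Fin; suc; toℕ; inject₁)
open import Data.Fin.Properties using (toℕ-inject₁; toℕ-injective)
open import Data.Fin.Induction using (<-weakInduction)
open import Data.Fin.Subset using (Subset)
open import Data.List using (List; []; _∷_)
open import Data.List.Membership.Propositional using () renaming (_∈_ to _∈ₗ_)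
open import Data.List.Relation.Unary.Any using (here; there)
open import Data.Product using (_,_; proj₁; proj₂)
open import Data.Sum using (inj₁; inj₂)
open import Data.Unit using (⊤; tt)
open import Data.Empty using (⊥; ⊥-elim)
open import Relation.Nullary using (¬_)
open import Relation.Binary using (tri<; tri≈; tri>)
open import Relation.Binary.PropositionalEquality using (_≡_; _≢_; refl; sym; trans; subst)

firstChoice-taken : ∀ {M W} {I : Instance M W} {μ : M → W → Set} → IsStable I μ →
                    ∀ {a b w} {bs : List W} → prefM I a ≡ b ∷ bs → a ∈ₗ prefW I b →
                    μ a w → w ≢ b → ¬ (∀ a' → ¬ μ a' b)
firstChoice-taken {I = I} {μ} stable {a} {b} {w} {bs} prefA a∈b μw w≢b bFree =
  noBlock a b (b∈a , a∈b) (λ μb → w≢b (funM a w b μw μb)) (aPrefers , inj₁ bFree)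
  where
  open IsStable stable
  open IsMatching matching

  b∈a : b ∈ₗ prefM I a
  b∈a = subst (b ∈ₗ_) (sym prefA) (here refl)

  w∈bs : w ∈ₗ bs
  w∈bs with subst (w ∈ₗ_) prefA (proj₁ (inE a w μw))
  ... | here w≡b   = ⊥-elim (w≢b w≡b)
  ... | there w∈bs = w∈bs

  aPrefers : PrefersM I μ a b
  aPrefers = inj₂ (w , μw , [] , bs , prefA , w∈bs)

module Copies {nA nB : ℕ} (G : Instance (Fin nA) (Fin nB)) (C : Subset nA) where
  open Construction G C

  module _ {μ : Men'' → Women'' → Set} (stable : IsStable G'' μ) (m : Fin nA) where
    open IsStable stable
    open IsMatching matching

    lowerDummy-taken : (j : Fin (top m)) {w : Women''} → μ (m , suc j) w → w ≢ inj₂ (m , j) →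
                       ¬ ¬ μ (m , inject₁ j) (inj₂ (m , j))
    lowerDummy-taken j {w} μw w≢d notHeld =
      firstChoice-taken stable refl (there (here refl)) μw w≢d dummyFree
      where
      dummyFree : ∀ a' → ¬ μ a' (inj₂ (m , j))
      dummyFree a' μa' with proj₂ (inE a' _ μa')
      ... | here refl         = notHeld μa'
      ... | there (here refl) = w≢d (funM _ _ _ μw μa')
      ... | there (there ())

    -- Excludes every dummy of index below k; among the possible partners of m^k that is
    -- exactly its lower dummy d_m^k.
    NotLowerDummy : Fin (suc (top m)) → Women'' → Set
    NotLowerDummy k (inj₁ _)       = ⊤
    NotLowerDummy k (inj₂ (_ , j)) = toℕ k ≤ toℕ j

    copiesAbove-pinned : {i : Fin (suc (top m))} {b : Fin nB} → μ (m , i) (inj₁ b) →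
                         (k : Fin (suc (top m))) → toℕ i < toℕ k →
                         ∀ w → μ (m , k) w → ¬ NotLowerDummy k w
    copiesAbove-pinned {i} {b} μb = <-weakInduction Pinned (λ ()) step
      where
      Pinned : Fin (suc (top m)) → Set
      Pinned k = toℕ i < toℕ k → ∀ w → μ (m , k) w → ¬ NotLowerDummy k w

      step : ∀ j → Pinned (inject₁ j) → Pinned (suc j)
      step j pinnedBelow i<1+j w μw notLower =
        lowerDummy-taken j μw (λ { refl → 1+n≰n notLower }) notOnUpperDummy
        where
        notOnUpperDummy : ¬ μ (m , inject₁ j) (inj₂ (m , j))
        notOnUpperDummy μd with m<1+n⇒m<n∨m≡n i<1+j
        ... | inj₁ i<j = pinnedBelow (subst (toℕ i <_) (sym (toℕ-inject₁ j)) i<j)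
                                     _ μd (≤-reflexive (toℕ-inject₁ j))
        ... | inj₂ i≡j with toℕ-injective (trans i≡j (sym (toℕ-inject₁ j)))
        ...   | refl with funM _ _ _ μb μd
        ...     | ()

mainTheorem11 : {nA nB : ℕ} (G : Instance (Fin nA) (Fin nB)) → WellFormed G → (C : Subset nA) →
    let open Construction G C in
    (μ : Men'' → Women'' → Set) → IsStable G'' μ →
    (m : Fin nA) (i j : Fin (suc (top m))) (b b' : Fin nB) →
    μ (m , i) (inj₁ b) → μ (m , j) (inj₁ b') → i ≡ j
mainTheorem11 G _ C μ stable m i j b b' μi μj with <-cmp (toℕ i) (toℕ j)
... | tri< i<j _ _ = ⊥-elim (Copies.copiesAbove-pinned G C stable m μi j i<j _ μj tt)
... | tri≈ _ i≡j _ = toℕ-injective i≡j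
... | tri> _ _ j<i = ⊥-elim (Copies.copiesAbove-pinned G C stable m μj i j<i _ μi tt)
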